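{- Let $G$ be a connected graph and let $r,k\in\mathbb N$ with $r\ge2$ or $k=1$, and assume $kr/2<\Delta_r(G)$. Then for every set $X\subseteq V(G)$ with $|X|\le k$, the following are equivalent: (i) $X$ is $r$-tomic; (ii) $X$ is $r$-locally $1$-sheeted.
   Context: Graphs are simple. A closed walk at $x_0$ stems from a cycle $O$ if it is $W_0QW_0^-$ with $Q$ traversing each edge of $O$ exactly once; the $r$-local subgroup $\pi_1^r(G,x_0)$ of the combinatorial fundamental group (closed walks at $x_0$ modulo removing backtracks $ueveu\to u$) is generated by the closed walks stemming from cycles of length $\le r$. A covering is an epimorphism $p\colon C\to G$ mapping the edges at each vertex $v$ bijectively onto those at $p(v)$. The $r$-local covering $p_r\colon G_r\to G$ is the covering, unique up to isomorphism, with $p_r$ inducing an isomorphism $\pi_1(G_r,\hat x_0)\to\pi_1^r(G,x_0)$. Displacement $\Delta_r(G)$: minimum distance in $G_r$ between distinct vertices with the same image under $p_r$ ($\infty$ if none). In any graph $H$ (applied to $G$ and to $G_r$, with the same $r$): a short cycle has length $\le r$; an $r$-local $X$-path is a path with at least one edge, ends in $X$ and inner vertices outside $X$, that is contained in a short cycle or is a single edge; $\mathcal W_r(X)$ is the set of walks that are concatenations of $r$-local $X$-paths and repeat no vertex of $X$; the $r$-toms of $X$ are the inclusion-maximal $X'\subseteq X$ any two of whose vertices are joined by a walk in $\mathcal W_r(X)$; $X$ is $r$-tomic if it has exactly one $r$-tom. A set $X\subseteq V(G)$ is $r$-locally $1$-sheeted if it is $r$-tomic and $p_r$ restricts to a bijection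 $\hat X\to X$ for some (equivalently every) $r$-tom $\hat X$ of $p_r^{ -1}(X)$ in $G_r$. -}

module Defs where

open import Data.Nat using (ℕ; zero; suc; _+_; _*_; _≤_; _<_)
open import Data.List using (List; []; _∷_; _++_; length)
open import Data.List.Membership.Propositional using (_∈_)
open import Data.List.Relation.Unary.All using (All)
open import Data.List.Relation.Unary.Any using (Any)
open import Data.List.Relation.Unary.Unique.Propositional using (Unique)
open import Data.Product using (Σ; ∃; _×_; _,_; proj₁)
open import Data.Sum using (_⊎_)
open import Data.Unit using (⊤)
open import Data.Empty using (⊥)
open import Relation.Nullary using (¬_)
open import Relation.Binary.PropositionalEquality using (_≡_; _≢_)
open import Relation.Binary.Construct.Closure.Equivalence using (EqClosure)

record Graph : Set₁ where
  field
    V      : Set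
    E      : V → V → Set
    E-sym  : ∀ {u v} → E u v → E v u
    E-irr  : ∀ {u} → ¬ E u u
    E-prop : ∀ {u v} (e e′ : E u v) → e ≡ e′

Subset : Set → Set₁
Subset V = V → Set

_⊆_ : {V : Set} → Subset V → Subset V → Set
X ⊆ Y = ∀ v → X v → Y v

module _ (G : Graph) where
  open Graph G

  data Walk : V → V → Set where
    []  : ∀ {u} → Walk u u
    _∷_ : ∀ {u w v} → E u w → Walk w v → Walk u v

  infixr 5 _∷_

  _++ʷ_ : ∀ {u v w} → Walk u v → Walk v w → Walk u w
  [] ++ʷ q = q
  (e ∷ p) ++ʷ q = e ∷ (p ++ʷ q)

  rev : ∀ {u v} → Walk u v → Walk v u
  rev [] = []
  rev (e ∷ p) = rev p ++ʷ (E-sym e ∷ [])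

  len : ∀ {u v} → Walk u v → ℕ
  len [] = 0
  len (e ∷ p) = suc (len p)

  verts : ∀ {u v} → Walk u v → List V
  verts {u} [] = u ∷ []
  verts {u} (e ∷ p) = u ∷ verts p

  edges : ∀ {u v} → Walk u v → List (V × V)
  edges [] = []
  edges {u} (_∷_ {w = w} e p) = (u , w) ∷ edges p

  SameEdge : V × V → V × V → Set
  SameEdge (a , b) (c , d) = (a ≡ c × b ≡ d) ⊎ (a ≡ d × b ≡ c)

  -- combinatorial fundamental group: reduction ueveu → u

  data Backtrack : ∀ {u v} → Walk u v → Walk u v → Set where
    bt : ∀ {u a v} (pre : Walk u a) {b} (e : E a b) (e′ : E b a) (post : Walk a v) →
         Backtrack (pre ++ʷ (e ∷ e′ ∷ post)) (pre ++ʷ post)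

  _≃_ : ∀ {u v} → Walk u v → Walk u v → Set
  _≃_ {u} {v} = EqClosure (Backtrack {u} {v})

  -- cycles: closed walks of length ≥ 3 with no repeated vertex
  -- (apart from start = end); the cycle (as subgraph) consists of the
  -- vertices and edges traversed.

  record Cycle : Set where
    constructor cyc
    field
      base  : V
      walk  : Walk base base
      long  : 3 ≤ len walk
      inj   : Unique (Data.List.drop 1 (verts walk))

  open Cycle public

  cycLength : Cycle → ℕ
  cycLength O = len (walk O)

  EdgeOf : Cycle → V × V → Set
  EdgeOf O e = Any (SameEdge e) (edges (walk O))

  ExactlyOnce : {A : Set} → (A → Set) → List A → Set
  ExactlyOnce {A} P l = Σ (List A) λ l₁ → Σ (List A) λ l₂ → Σ A λ x →
    (l ≡ l₁ ++ x ∷ l₂) × P x × All (λ y → ¬ P y) l₁ × All (λ y → ¬ P y) l₂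

  Traverses : ∀ {y} → Walk y y → Cycle → Set
  Traverses Q O = (∀ e → EdgeOf O e → ExactlyOnce (SameEdge e) (edges Q))
                × All (EdgeOf O) (edges Q)

  StemsFrom : ∀ {x₀} → Walk x₀ x₀ → Cycle → Set
  StemsFrom {x₀} w O = Σ V λ y → Σ (Walk x₀ y) λ W₀ → Σ (Walk y y) λ Q →
    Traverses Q O × (w ≡ W₀ ++ʷ (Q ++ʷ rev W₀))

  ShortCycle : ℕ → Cycle → Set
  ShortCycle r O = cycLength O ≤ r

  StemsShort : ℕ → ∀ {x₀} → Walk x₀ x₀ → Set
  StemsShort r w = Σ Cycle λ O → ShortCycle r O × StemsFrom w O

  data Generated (r : ℕ) {x₀ : V} : Walk x₀ x₀ → Set where
    gen-nil : Generated r []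
    gen-pos : ∀ {w w′} → StemsShort r w → Generated r w′ → Generated r (w ++ʷ w′)
    gen-neg : ∀ {w w′} → StemsShort r w → Generated r w′ → Generated r (rev w ++ʷ w′)

  -- membership of (the class of) a closed walk in π₁ʳ(G, x₀)
  InLocalGroup : ℕ → ∀ {x₀} → Walk x₀ x₀ → Set
  InLocalGroup r {x₀} w = Σ (Walk x₀ x₀) λ w′ → Generated r w′ × (w ≃ w′)

  Connected : Set
  Connected = ∀ u v → Walk u v

  IsPath : ∀ {u v} → Walk u v → Set
  IsPath p = (1 ≤ len p) × Unique (verts p)

  InnerAvoid : Subset V → ∀ {u v} → Walk u v → Set
  InnerAvoid X [] = ⊤
  InnerAvoid X (e ∷ []) = ⊤
  InnerAvoid X (_∷_ {w = w} e (e′ ∷ p)) = ¬ X w × InnerAvoid X (e′ ∷ p)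

  ContainedIn : ∀ {u v} → Walk u v → Cycle → Set
  ContainedIn p O = All (EdgeOf O) (edges p)

  LocalXPath : ℕ → Subset V → ∀ {u v} → Walk u v → Set
  LocalXPath r X {u} {v} p =
    IsPath p × X u × X v × InnerAvoid X p ×
    ((Σ Cycle λ O → ShortCycle r O × ContainedIn p O) ⊎ len p ≡ 1)

  data ConcatLocal (r : ℕ) (X : Subset V) : ∀ {u v} → Walk u v → Set where
    c-nil  : ∀ {u} → ConcatLocal r X ([] {u})
    c-cons : ∀ {u w v} {p : Walk u w} {q : Walk w v} →
             LocalXPath r X p → ConcatLocal r X q → ConcatLocal r X (p ++ʷ q)

  NoRepeatIn : Subset V → List V → Set
  NoRepeatIn X l = ∀ x → X x → ∀ l₁ l₂ l₃ → ¬ (l ≡ l₁ ++ x ∷ l₂ ++ x ∷ l₃)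

  InW : ℕ → Subset V → ∀ {u v} → Walk u v → Set
  InW r X w = ConcatLocal r X w × NoRepeatIn X (verts w)

  PairwiseJoined : ℕ → Subset V → Subset V → Set
  PairwiseJoined r X X′ = ∀ a b → X′ a → X′ b → Σ (Walk a b) λ w → InW r X w

  IsTom : ℕ → Subset V → Subset V → Set₁
  IsTom r X X′ = X′ ⊆ X × PairwiseJoined r X X′ ×
    (∀ (Y : Subset V) → X′ ⊆ Y → Y ⊆ X → PairwiseJoined r X Y → Y ⊆ X′)

  Tomic : ℕ → Subset V → Set₁
  Tomic r X = Σ (Subset V) λ T → IsTom r X T ×
    (∀ T′ → IsTom r X T′ → (T′ ⊆ T × T ⊆ T′))

module _ (C G : Graph) where
  private
    module C = Graph C
    module G = Graph G

  record IsCovering (p : C.V → G.V) : Set where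
    field
      hom      : ∀ {u v} → C.E u v → G.E (p u) (p v)
      surj     : ∀ y → Σ C.V λ v → p v ≡ y
      loc-inj  : ∀ {v a b} → C.E v a → C.E v b → p a ≡ p b → a ≡ b
      loc-surj : ∀ {v y} → G.E (p v) y → Σ C.V λ a → C.E v a × p a ≡ y

  mapWalk : {p : C.V → G.V} → IsCovering p → ∀ {u v} → Walk C u v → Walk G (p u) (p v)
  mapWalk cov [] = []
  mapWalk cov (e ∷ w) = IsCovering.hom cov e ∷ mapWalk cov w

  -- p : C → G (with base point x̂₀, x₀ = p x̂₀) is an r-local covering:
  -- C is connected, and p induces an isomorphism
  -- π₁(C, x̂₀) → π₁ʳ(G, p x̂₀).
  record IsLocalCovering (r : ℕ) (p : C.V → G.V) (x̂₀ : C.V) : Set where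
    field
      covering  : IsCovering p
      connected : Connected C
      -- well defined and injective
      induced-iff : ∀ (w w′ : Walk C x̂₀ x̂₀) →
        (_≃_ C w w′ → _≃_ G (mapWalk covering w) (mapWalk covering w′)) ×
        (_≃_ G (mapWalk covering w) (mapWalk covering w′) → _≃_ C w w′)
      image-local : ∀ (w : Walk C x̂₀ x̂₀) → InLocalGroup G r (mapWalk covering w)
      onto-local : ∀ (w : Walk G (p x̂₀) (p x̂₀)) → InLocalGroup G r w →
        Σ (Walk C x̂₀ x̂₀) λ w′ → _≃_ G (mapWalk covering w′) w

  -- "m/2 < Δ": every two distinct vertices of C in the same fibre have
  -- distance greater than m/2, i.e. every walk between them has length ℓ with m < 2ℓ
  DisplacementAbove : (p : C.V → G.V) → ℕ → Set
  DisplacementAbove p m = ∀ a b → a ≢ b → p a ≡ p b → (w : Walk C a b) → m < 2 * len C w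

  Preimage : (p : C.V → G.V) → Subset G.V → Subset C.V
  Preimage p X a = X (p a)

  OneSheeted : ℕ → (p : C.V → G.V) → Subset G.V → Set₁
  OneSheeted r p X = Tomic G r X ×
    Σ (Subset C.V) λ X̂ → IsTom C r (Preimage p X) X̂ ×
      (∀ a b → X̂ a → X̂ b → p a ≡ p b → a ≡ b) ×
      (∀ x → X x → Σ C.V λ a → X̂ a × p a ≡ x)

-- Lifting along p maps short cycles onto short cycles (a walk around a short cycle lies in
-- π₁ʳ, so its lifts close up), hence r-local X-paths lift to r-local paths between vertices over X.
-- If X is r-tomic, its vertices are pairwise joined by walks in 𝒲_r(X). Lifting these one local path
-- at a time, always towards a vertex of X not yet covered, grows a set X̂ over X on which p is
-- injective and whose vertices are pairwise joined in 𝒲_r(p⁻¹X). It is a whole r-tom because a walk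
-- in 𝒲_r(p⁻¹X) never joins two distinct vertices of one fibre: consecutive vertices over X along it
-- are within distance r/2 (this is where r ≥ 2 enters), and at the first repetition of a fibre at
-- most |X| ≤ k of them have been passed, giving distance ≤ kr/2 < Δ_r. For k = 1 no local path joins
-- two vertices over X at all. The converse is part of the definition of being 1-sheeted.
module Submission where

open import Defs
open import Data.Nat using (ℕ; suc; _+_; _*_; _≤_; z≤n; s≤s)
open import Data.Nat.Properties
open import Data.Sum using (_⊎_; inj₁; inj₂)
open import Data.Product using (_×_; Σ; _,_; proj₁; proj₂; swap)
open import Data.List using (List; []; _∷_; _++_; _∷ʳ_; [_]; length; map; reverse)
open import Data.List.Properties
  using (++-assoc; unfold-reverse; reverse-++; ∷-injectiveʳ; ∷ʳ-injectiveˡ; length-removeAt′; length-map)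
open import Data.List.Membership.Propositional using (_∈_; _∉_; find; lose)
open import Data.List.Membership.Propositional.Properties
  using (∈-++⁺ˡ; ∈-++⁺ʳ; ∈-++⁻; ∈-∃++; ∈-map⁺; ∈-map⁻)
open import Data.List.Relation.Unary.All as All using (All; []; _∷_)
import Data.List.Relation.Unary.All.Properties as All
open import Data.List.Relation.Unary.Any as Any using (Any; here; there; index; _─_)
import Data.List.Relation.Unary.Any.Properties as Any
open import Data.List.Relation.Unary.AllPairs using (AllPairs; []; _∷_)
import Data.List.Relation.Unary.AllPairs.Properties as AllPairs
open import Data.List.Relation.Unary.Linked as Linked using (Linked; [-]; _∷_)
import Data.List.Relation.Unary.First as First
open import Data.List.Relation.Unary.Unique.Propositional using (Unique)
open import Data.List.Relation.Unary.Unique.Propositional.Properties as Unique using (Unique[x∷xs]⇒x∉xs)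
import Data.List.Relation.Binary.Permutation.Setoid as Permutation
import Data.List.Relation.Binary.Permutation.Setoid.Properties as Permutation
open import Relation.Binary.Construct.Closure.ReflexiveTransitive using (Star; ε; _◅_; _◅◅_)
open import Relation.Binary.Construct.Closure.Symmetric using (fwd; bwd)
open import Data.Empty using (⊥; ⊥-elim)
open import Data.Unit using (tt)
open import Function using (_∘_)
open import Relation.Binary.PropositionalEquality hiding ([_])
open import Relation.Nullary using (¬_; Dec; yes; no)

module _ {A : Set} where

  Unique-reverse⁺ : {l : List A} → Unique l → Unique (reverse l)
  Unique-reverse⁺ {l} =
    Permutation.Unique-resp-↭ (setoid A) (Permutation.↭-sym (setoid A) (Permutation.↭-reverse (setoid A) l))

  Unique-++⁻ʳ : (m : List A) {l : List A} → Unique (m ++ l) → Unique l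
  Unique-++⁻ʳ []      u       = u
  Unique-++⁻ʳ (x ∷ m) (_ ∷ u) = Unique-++⁻ʳ m u

  ∈-Unique-≟ : {l : List A} → Unique l → ∀ {x y} → x ∈ l → y ∈ l → Dec (x ≡ y)
  ∈-Unique-≟ u       (here refl) (here refl) = yes refl
  ∈-Unique-≟ u       (here refl) (there y∈) = no λ { refl → Unique[x∷xs]⇒x∉xs u y∈ }
  ∈-Unique-≟ u       (there x∈) (here refl) = no λ { refl → Unique[x∷xs]⇒x∉xs u x∈ }
  ∈-Unique-≟ (_ ∷ u) (there x∈) (there y∈) = ∈-Unique-≟ u x∈ y∈

  Unique-map⇒injective : ∀ {B : Set} (f : A → B) {l : List A} → Unique (map f l) →
                          ∀ {x y} → x ∈ l → y ∈ l → f x ≡ f y → x ≡ y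
  Unique-map⇒injective f u       (here refl) (here refl) _ = refl
  Unique-map⇒injective f (fx∉ ∷ _) (here refl) (there y∈) fx≡fy =
    ⊥-elim (All.lookup fx∉ (∈-map⁺ f y∈) fx≡fy)
  Unique-map⇒injective f (fy∉ ∷ _) (there x∈) (here refl) fx≡fy =
    ⊥-elim (All.lookup fy∉ (∈-map⁺ f x∈) (sym fx≡fy))
  Unique-map⇒injective f (_ ∷ u) (there x∈) (there y∈) fx≡fy = Unique-map⇒injective f u x∈ y∈ fx≡fy

  ∈-─⁺ : ∀ {x y} {m : List A} (x∈m : x ∈ m) → y ∈ m → y ≢ x → y ∈ (m ─ x∈m)
  ∈-─⁺ (here refl) (here refl) y≢x = ⊥-elim (y≢x refl)
  ∈-─⁺ (here refl) (there y∈)  _   = y∈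
  ∈-─⁺ (there x∈)  (here refl) _   = here refl
  ∈-─⁺ (there x∈)  (there y∈)  y≢x = there (∈-─⁺ x∈ y∈ y≢x)

  Unique-⊆⇒length-≤ : {l m : List A} → Unique l → (∀ {x} → x ∈ l → x ∈ m) → length l ≤ length m
  Unique-⊆⇒length-≤ {[]}    _          _   = z≤n
  Unique-⊆⇒length-≤ {x ∷ l} {m} (x∉l ∷ u) l⊆m =
    subst (suc (length l) ≤_) (sym (length-removeAt′ m (index x∈m)))
      (s≤s (Unique-⊆⇒length-≤ u λ y∈l →
        ∈-─⁺ x∈m (l⊆m (there y∈l)) λ { refl → All.lookup x∉l y∈l refl }))
    where x∈m = l⊆m (here refl)

  AllPairs-++⁻ˡ : ∀ {R : A → A → Set} (l : List A) {m} → AllPairs R (l ++ m) → AllPairs R l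
  AllPairs-++⁻ˡ []      _          = []
  AllPairs-++⁻ˡ (x ∷ l) (rx ∷ rs) = All.++⁻ˡ l rx ∷ AllPairs-++⁻ˡ l rs

  ∈-dec : {R : A → Set} → (∀ {x y} → R x → R y → Dec (x ≡ y)) →
          ∀ {a l} → R a → All R l → Dec (a ∈ l)
  ∈-dec _≟R_ Ra []        = no λ ()
  ∈-dec _≟R_ Ra (Ry ∷ Rl) with Ra ≟R Ry | ∈-dec _≟R_ Ra Rl
  ... | yes a≡y | _      = yes (here a≡y)
  ... | no _    | yes a∈ = yes (there a∈)
  ... | no a≢y  | no a∉  = no λ { (here a≡y) → a≢y a≡y ; (there a∈) → a∉ a∈ }

  allOrFirst : ∀ {P Q R : A → Set} → (∀ {a} → R a → P a ⊎ Q a) →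
               ∀ {l} → All R l → All P l ⊎ First.FirstView P Q l
  allOrFirst decide []        = inj₁ []
  allOrFirst decide (Ra ∷ Rl) with decide Ra | allOrFirst decide Rl
  ... | inj₂ Qa | _                     = inj₂ (First._++_∷_ [] Qa _)
  ... | inj₁ Pa | inj₁ Pl               = inj₁ (Pa ∷ Pl)
  ... | inj₁ Pa | inj₂ (First._++_∷_ Pl Qy l) = inj₂ (First._++_∷_ (Pa ∷ Pl) Qy l)

  length≤1⇒∈-unique : ∀ {l : List A} → length l ≤ 1 → ∀ {x y} → x ∈ l → y ∈ l → x ≡ y
  length≤1⇒∈-unique {_ ∷ []}    _         (here refl) (here refl) = refl
  length≤1⇒∈-unique {_ ∷ _ ∷ _} (s≤s ()) _ _

  All-reverse⁺ : ∀ {P : A → Set} {l : List A} → All P l → All P (reverse l)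
  All-reverse⁺ ps = All.tabulate λ x∈ → All.lookup ps (Any.reverse⁻ x∈)

half-of-sum : ∀ {m n b} → m + n ≤ b → 2 * m ≤ b ⊎ 2 * n ≤ b
half-of-sum {m} {n} m+n≤b with ≤-total m n
... | inj₁ m≤n = inj₁ (≤-trans (+-mono-≤ (≤-refl {m}) (≤-trans (≤-reflexive (+-identityʳ m)) m≤n)) m+n≤b)
... | inj₂ n≤m = inj₂ (≤-trans (+-mono-≤ n≤m (≤-reflexive (+-identityʳ n))) m+n≤b)

infixr 5 _⊕_

_⊕_ : {H : Graph} {u v w : Graph.V H} → Walk H u v → Walk H v w → Walk H u w
_⊕_ {H} = _++ʷ_ H

module _ {H : Graph} where
  open Graph H

  ⊕-identityʳ : ∀ {a b} (p : Walk H a b) → p ⊕ [] ≡ p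
  ⊕-identityʳ []      = refl
  ⊕-identityʳ (e ∷ p) = cong (e ∷_) (⊕-identityʳ p)

  len-⊕ : ∀ {a b c} (p : Walk H a b) (q : Walk H b c) → len H (p ⊕ q) ≡ len H p + len H q
  len-⊕ []      q = refl
  len-⊕ (e ∷ p) q = cong suc (len-⊕ p q)

  len-rev : ∀ {a b} (p : Walk H a b) → len H (rev H p) ≡ len H p
  len-rev []      = refl
  len-rev (e ∷ p) = begin
    len H (rev H p ⊕ (E-sym e ∷ []))  ≡⟨ len-⊕ (rev H p) _ ⟩
    len H (rev H p) + 1               ≡⟨ +-comm (len H (rev H p)) 1 ⟩
    suc (len H (rev H p))             ≡⟨ cong suc (len-rev p) ⟩
    suc (len H p)                     ∎
    where open ≡-Reasoning

  length-1⇒edge : ∀ {a b} (p : Walk H a b) → len H p ≡ 1 → E a b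
  length-1⇒edge (e ∷ []) _ = e

  initVerts : ∀ {a b} → Walk H a b → List V
  initVerts []          = []
  initVerts {a} (e ∷ p) = a ∷ initVerts p

  inner : ∀ {a b} → Walk H a b → List V
  inner []      = []
  inner (e ∷ p) = initVerts p

  verts-⊕ : ∀ {a b c} (p : Walk H a b) (q : Walk H b c) → verts H (p ⊕ q) ≡ initVerts p ++ verts H q
  verts-⊕ []          q = refl
  verts-⊕ {a} (e ∷ p) q = cong (a ∷_) (verts-⊕ p q)

  verts-initVerts : ∀ {a b} (p : Walk H a b) → verts H p ≡ initVerts p ∷ʳ b
  verts-initVerts []          = refl
  verts-initVerts {a} (e ∷ p) = cong (a ∷_) (verts-initVerts p)

  verts-inner : ∀ {a b} (p : Walk H a b) → 1 ≤ len H p → verts H p ≡ a ∷ inner p ∷ʳ b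
  verts-inner {a} (e ∷ p) _ = cong (a ∷_) (verts-initVerts p)

  verts-rev : ∀ {a b} (p : Walk H a b) → verts H (rev H p) ≡ reverse (verts H p)
  verts-rev []                      = refl
  verts-rev {a} (_∷_ {w = w} e p) = begin
    verts H (rev H p ⊕ (E-sym e ∷ []))  ≡⟨ verts-⊕ (rev H p) _ ⟩
    initVerts (rev H p) ++ w ∷ a ∷ []    ≡⟨ ++-assoc (initVerts (rev H p)) [ w ] [ a ] ⟨
    (initVerts (rev H p) ∷ʳ w) ∷ʳ a      ≡⟨ cong (_∷ʳ a) (verts-initVerts (rev H p)) ⟨
    verts H (rev H p) ∷ʳ a               ≡⟨ cong (_∷ʳ a) (verts-rev p) ⟩
    reverse (verts H p) ∷ʳ a             ≡⟨ unfold-reverse a (verts H p) ⟨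
    reverse (a ∷ verts H p)              ∎
    where open ≡-Reasoning

  inner-rev : ∀ {a b} (p : Walk H a b) → inner (rev H p) ≡ reverse (inner p)
  inner-rev []          = refl
  inner-rev {a} {b} p@(e ∷ q) = ∷ʳ-injectiveˡ _ _ (∷-injectiveʳ (begin
    b ∷ inner (rev H p) ∷ʳ a         ≡⟨ verts-inner (rev H p) (subst (1 ≤_) (sym (len-rev p)) (s≤s z≤n)) ⟨
    verts H (rev H p)                ≡⟨ verts-rev p ⟩
    reverse (verts H p)              ≡⟨ cong reverse (verts-inner p (s≤s z≤n)) ⟩
    reverse (a ∷ inner p ∷ʳ b)       ≡⟨ reverse-++ (a ∷ inner p) [ b ] ⟩
    b ∷ reverse (a ∷ inner p)        ≡⟨ cong (b ∷_) (unfold-reverse a (inner p)) ⟩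
    b ∷ reverse (inner p) ∷ʳ a       ∎))
    where open ≡-Reasoning

  edges-⊕ : ∀ {a b c} (p : Walk H a b) (q : Walk H b c) → edges H (p ⊕ q) ≡ edges H p ++ edges H q
  edges-⊕ []      q = refl
  edges-⊕ (e ∷ p) q = cong (_ ∷_) (edges-⊕ p q)

  edges-rev : ∀ {a b} (p : Walk H a b) → edges H (rev H p) ≡ reverse (map swap (edges H p))
  edges-rev []                      = refl
  edges-rev {a} (_∷_ {w = w} e p) = begin
    edges H (rev H p ⊕ (E-sym e ∷ []))     ≡⟨ edges-⊕ (rev H p) _ ⟩
    edges H (rev H p) ∷ʳ (w , a)           ≡⟨ cong (_∷ʳ (w , a)) (edges-rev p) ⟩
    reverse (map swap (edges H p)) ∷ʳ (w , a) ≡⟨ unfold-reverse (w , a) (map swap (edges H p)) ⟨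
    reverse (map swap (edges H (e ∷ p)))   ∎
    where open ≡-Reasoning

  start∈verts : ∀ {a b} (p : Walk H a b) → a ∈ verts H p
  start∈verts []      = here refl
  start∈verts (e ∷ p) = here refl

  end∈verts : ∀ {a b} (p : Walk H a b) → b ∈ verts H p
  end∈verts []      = here refl
  end∈verts (e ∷ p) = there (end∈verts p)

  initVerts⊆verts : ∀ {a b x} (p : Walk H a b) → x ∈ initVerts p → x ∈ verts H p
  initVerts⊆verts p m = subst (_ ∈_) (sym (verts-initVerts p)) (∈-++⁺ˡ m)

  split-at : ∀ {a b x} (p : Walk H a b) → x ∈ verts H p →
             Σ (Walk H a x) λ p₁ → Σ (Walk H x b) λ p₂ → p ≡ p₁ ⊕ p₂
  split-at []      (here refl) = [] , [] , refl
  split-at (e ∷ p) (here refl) = [] , e ∷ p , refl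
  split-at (e ∷ p) (there m) with split-at p m
  ... | p₁ , p₂ , refl = e ∷ p₁ , p₂ , refl

  TraversedBy : ∀ {a b} → Walk H a b → V × V → Set
  TraversedBy p (x , y) = E x y × x ∈ verts H p × y ∈ verts H p

  edges-traversed : ∀ {a b} (p : Walk H a b) → All (TraversedBy p) (edges H p)
  edges-traversed []      = []
  edges-traversed (e ∷ p) = (e , here refl , there (start∈verts p))
    ∷ All.map (λ (f , x∈ , y∈) → f , there x∈ , there y∈) (edges-traversed p)

WithinHalf : (H : Graph) → ℕ → Graph.V H → Graph.V H → Set
WithinHalf H n u v = Σ (Walk H u v) λ w → 2 * len H w ≤ n

withinHalf-span : ∀ {H : Graph} {r x} B {y D} → Linked (WithinHalf H r) (x ∷ B ++ y ∷ D) →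
                  WithinHalf H (suc (length B) * r) x y
withinHalf-span {H} {r} [] ((w , 2|w|≤r) ∷ _) = w , subst (2 * len H w ≤_) (sym (+-identityʳ r)) 2|w|≤r
withinHalf-span {H} {r} (_ ∷ B) ((w₁ , 2|w₁|≤) ∷ linked) with withinHalf-span B linked
... | w₂ , 2|w₂|≤ = w₁ ⊕ w₂ , (begin
  2 * len H (w₁ ⊕ w₂)          ≡⟨ cong (2 *_) (len-⊕ w₁ w₂) ⟩
  2 * (len H w₁ + len H w₂)    ≡⟨ *-distribˡ-+ 2 (len H w₁) (len H w₂) ⟩
  2 * len H w₁ + 2 * len H w₂  ≤⟨ +-mono-≤ 2|w₁|≤ 2|w₂|≤ ⟩
  r + suc (length B) * r       ∎)
  where open ≤-Reasoning

module _ {H : Graph} where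
  open Graph H

  rotate-verts : ∀ {a b x} (p : Walk H a b) (q : Walk H b a) → x ∈ verts H (p ⊕ q) → x ∈ verts H (q ⊕ p)
  rotate-verts p q x∈ with ∈-++⁻ (initVerts p) (subst (_ ∈_) (verts-⊕ p q) x∈)
  ... | inj₁ x∈p = subst (_ ∈_) (sym (verts-⊕ q p)) (∈-++⁺ʳ (initVerts q) (initVerts⊆verts p x∈p))
  ... | inj₂ x∈q with ∈-++⁻ (initVerts q) (subst (_ ∈_) (verts-initVerts q) x∈q)
  ...   | inj₁ x∈q′       = subst (_ ∈_) (sym (verts-⊕ q p)) (∈-++⁺ˡ x∈q′)
  ...   | inj₂ (here refl) = subst (_ ∈_) (sym (verts-⊕ q p)) (∈-++⁺ʳ (initVerts q) (start∈verts p))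

  closedWalk-withinHalf : ∀ {q a b} (Q : Walk H q q) → a ∈ verts H Q → b ∈ verts H Q →
                          WithinHalf H (len H Q) a b
  closedWalk-withinHalf Q a∈ b∈ with split-at Q a∈
  ... | Q₁ , Q₂ , refl with split-at (Q₂ ⊕ Q₁) (rotate-verts Q₁ Q₂ b∈)
  ...   | P₁ , P₂ , R≡ with half-of-sum {len H P₁} {len H P₂} (≤-reflexive lengths)
    where
      open ≡-Reasoning
      lengths : len H P₁ + len H P₂ ≡ len H (Q₁ ⊕ Q₂)
      lengths = begin
        len H P₁ + len H P₂  ≡⟨ len-⊕ P₁ P₂ ⟨
        len H (P₁ ⊕ P₂)      ≡⟨ cong (len H) R≡ ⟨
        len H (Q₂ ⊕ Q₁)      ≡⟨ len-⊕ Q₂ Q₁ ⟩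
        len H Q₂ + len H Q₁  ≡⟨ +-comm (len H Q₂) (len H Q₁) ⟩
        len H Q₁ + len H Q₂  ≡⟨ len-⊕ Q₁ Q₂ ⟨
        len H (Q₁ ⊕ Q₂)      ∎
  ...     | inj₁ short = P₁ , short
  ...     | inj₂ short = rev H P₂ , subst (λ n → 2 * n ≤ _) (sym (len-rev P₂)) short

  SameEdge-swapˡ : ∀ {x y} f → SameEdge H (x , y) f → SameEdge H (y , x) f
  SameEdge-swapˡ _ (inj₁ (p , q)) = inj₂ (q , p)
  SameEdge-swapˡ _ (inj₂ (p , q)) = inj₁ (q , p)

  SameEdge-common : ∀ e f g → SameEdge H e f → SameEdge H e g → SameEdge H f g
  SameEdge-common _ _ _ (inj₁ (refl , refl)) (inj₁ (refl , refl)) = inj₁ (refl , refl)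
  SameEdge-common _ _ _ (inj₁ (refl , refl)) (inj₂ (refl , refl)) = inj₂ (refl , refl)
  SameEdge-common _ _ _ (inj₂ (refl , refl)) (inj₁ (refl , refl)) = inj₂ (refl , refl)
  SameEdge-common _ _ _ (inj₂ (refl , refl)) (inj₂ (refl , refl)) = inj₁ (refl , refl)

  EdgeOf-swap : ∀ (O : Cycle H) e → EdgeOf H O e → EdgeOf H O (swap e)
  EdgeOf-swap O _ = Any.map (λ {f} → SameEdge-swapˡ f)

  EdgeOf⇒on-cycle : ∀ (O : Cycle H) {x y} → EdgeOf H O (x , y) →
                    x ∈ verts H (walk O) × y ∈ verts H (walk O)
  EdgeOf⇒on-cycle O = go (edges-traversed (walk O))
    where
      go : ∀ {x y l} → All (TraversedBy (walk O)) l → Any (SameEdge H (x , y)) l →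
           x ∈ verts H (walk O) × y ∈ verts H (walk O)
      go ((_ , c∈ , d∈) ∷ _) (here (inj₁ (refl , refl))) = c∈ , d∈
      go ((_ , c∈ , d∈) ∷ _) (here (inj₂ (refl , refl))) = d∈ , c∈
      go (_ ∷ t)              (there e∈)                   = go t e∈

  contained⇒ends-on-cycle : ∀ {a b} (s : Walk H a b) (O : Cycle H) → 1 ≤ len H s → ContainedIn H s O →
                            a ∈ verts H (walk O) × b ∈ verts H (walk O)
  contained⇒ends-on-cycle (e ∷ [])       O _ (e∈O ∷ _)  = EdgeOf⇒on-cycle O e∈O
  contained⇒ends-on-cycle (e ∷ s@(_ ∷ _)) O _ (e∈O ∷ s⊆O) =
    proj₁ (EdgeOf⇒on-cycle O e∈O) , proj₂ (contained⇒ends-on-cycle s O (s≤s z≤n) s⊆O)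

  localPath-withinHalf : ∀ {r a b} (s : Walk H a b) (O : Cycle H) → ShortCycle H r O → 1 ≤ len H s →
                         ContainedIn H s O → WithinHalf H r a b
  localPath-withinHalf s O short nonempty s⊆O with contained⇒ends-on-cycle s O nonempty s⊆O
  ... | a∈ , b∈ with closedWalk-withinHalf (walk O) a∈ b∈
  ...   | w , half = w , ≤-trans half short

  DistinctEdges : List (V × V) → Set
  DistinctEdges = AllPairs λ e f → ¬ SameEdge H e f

  path-distinctEdges : ∀ {a b} (w : Walk H a b) → Unique (verts H w) → DistinctEdges (edges H w)
  path-distinctEdges []      _            = []
  path-distinctEdges (e ∷ w) u@(_ ∷ u′) =
    All.map (λ { (_ , x∈ , _) (inj₁ (refl , _)) → Unique[x∷xs]⇒x∉xs u x∈
               ; (_ , _ , y∈) (inj₂ (refl , _)) → Unique[x∷xs]⇒x∉xs u y∈ })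
            (edges-traversed w)
    ∷ path-distinctEdges w u′

  closedPath-length : ∀ {a} (w : Walk H a a) → Unique (verts H w) → len H w ≡ 0
  closedPath-length []      _ = refl
  closedPath-length (e ∷ w) u = ⊥-elim (Unique[x∷xs]⇒x∉xs u (end∈verts w))

  path-ends-distinct : ∀ {a b} (w : Walk H a b) → IsPath H w → a ≢ b
  path-ends-distinct w (nonempty , u) refl = <⇒≢ nonempty (sym (closedPath-length w u))

  path-closingEdge : ∀ {s t} (w : Walk H s t) → Unique (verts H w) →
                     All (λ f → SameEdge H (t , s) f → len H w ≡ 1) (edges H w)
  path-closingEdge []      _            = []
  path-closingEdge (e ∷ w) u@(_ ∷ u′) =
    (λ { (inj₁ (refl , refl)) → ⊥-elim (Unique[x∷xs]⇒x∉xs u (start∈verts w))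
       ; (inj₂ (refl , _))    → cong suc (closedPath-length w u′) })
    ∷ All.map (λ { (_ , _ , y∈) (inj₁ (_ , refl)) → ⊥-elim (Unique[x∷xs]⇒x∉xs u y∈)
                 ; (_ , x∈ , _) (inj₂ (_ , refl)) → ⊥-elim (Unique[x∷xs]⇒x∉xs u x∈) })
              (edges-traversed w)

  cycle-distinctEdges : (O : Cycle H) → DistinctEdges (edges H (walk O))
  cycle-distinctEdges (cyc _ (e ∷ w) long u) =
    All.map (λ closing same → <⇒≱ long (≤-reflexive (cong suc (closing same))))
            (path-closingEdge w u)
    ∷ path-distinctEdges w u

  exactlyOnce : ∀ e {l} → Any (SameEdge H e) l → DistinctEdges l → ExactlyOnce H (SameEdge H e) l
  exactlyOnce e {x ∷ l} (here e~x) (x≁ ∷ _) =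
    [] , l , x , refl , e~x , [] , All.tabulate λ y∈ e~y → All.lookup x≁ y∈ (SameEdge-common e x _ e~x e~y)
  exactlyOnce e {x ∷ l} (there e∈) (x≁ ∷ d) with exactlyOnce e e∈ d
  ... | l₁ , l₂ , z , refl , e~z , before , after =
    x ∷ l₁ , l₂ , z , refl , e~z ,
    (λ e~x → All.lookup x≁ (∈-++⁺ʳ l₁ (here refl)) (SameEdge-common e x z e~x e~z)) ∷ before , after

  cycle-traverses : (O : Cycle H) → Traverses H (walk O) O
  cycle-traverses O =
    (λ e e∈ → exactlyOnce e e∈ (cycle-distinctEdges O)) ,
    All.tabulate λ f∈ → Any.map (λ { refl → inj₁ (refl , refl) }) f∈

ShortCycleOrEdge : (H : Graph) → ℕ → ∀ {a b} → Walk H a b → Set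
ShortCycleOrEdge H r s = (Σ (Cycle H) λ O → ShortCycle H r O × ContainedIn H s O) ⊎ len H s ≡ 1

module _ {H : Graph} (X : Subset (Graph.V H)) where
  open Graph H

  InnerAvoid⇒All : ∀ {a b} (s : Walk H a b) → InnerAvoid H X s → All (¬_ ∘ X) (inner s)
  InnerAvoid⇒All []               _         = []
  InnerAvoid⇒All (e ∷ [])         _         = []
  InnerAvoid⇒All (e ∷ s@(_ ∷ _)) (¬Xw , ia) = ¬Xw ∷ InnerAvoid⇒All s ia

  All⇒InnerAvoid : ∀ {a b} (s : Walk H a b) → All (¬_ ∘ X) (inner s) → InnerAvoid H X s
  All⇒InnerAvoid []               _           = tt
  All⇒InnerAvoid (e ∷ [])         _           = tt
  All⇒InnerAvoid (e ∷ s@(_ ∷ _)) (¬Xw ∷ ¬Xs) = ¬Xw , All⇒InnerAvoid s ¬Xs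

  LocalXPath-rev : ∀ {r a b} {s : Walk H a b} → LocalXPath H r X s → LocalXPath H r X (rev H s)
  LocalXPath-rev {r} {s = s} ((nonempty , u) , Xa , Xb , ia , local) =
    (subst (1 ≤_) (sym (len-rev s)) nonempty , subst Unique (sym (verts-rev s)) (Unique-reverse⁺ u)) ,
    Xb , Xa ,
    All⇒InnerAvoid (rev H s) (subst (All _) (sym (inner-rev s)) (All-reverse⁺ (InnerAvoid⇒All s ia))) ,
    reversed local
    where
      reversed : ShortCycleOrEdge H r s → ShortCycleOrEdge H r (rev H s)
      reversed (inj₁ (O , short , s⊆O)) = inj₁ (O , short ,
        subst (All (EdgeOf H O)) (sym (edges-rev s)) (All-reverse⁺ (All.map⁺ (All.map (EdgeOf-swap O _) s⊆O))))
      reversed (inj₂ single) = inj₂ (trans (len-rev s) single)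

module Chains (H : Graph) (r : ℕ) (X : Subset (Graph.V H)) where
  open Graph H

  LocalStep : V → V → Set
  LocalStep a b = Σ (Walk H a b) (LocalXPath H r X)

  Chain : V → V → Set
  Chain = Star LocalStep

  walkOf : ∀ {a c} → Chain a c → Walk H a c
  walkOf ε              = []
  walkOf ((s , _) ◅ ch) = s ⊕ walkOf ch

  stops : ∀ {a c} → Chain a c → List V
  stops {a} ε        = [ a ]
  stops {a} (_ ◅ ch) = a ∷ stops ch

  end∈stops : ∀ {a c} (ch : Chain a c) → c ∈ stops ch
  end∈stops ε        = here refl
  end∈stops (_ ◅ ch) = there (end∈stops ch)

  stops-▻ : ∀ {a b c} (ch : Chain a b) (step : LocalStep b c) → stops (ch ◅◅ (step ◅ ε)) ≡ stops ch ∷ʳ c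
  stops-▻ ε         _    = refl
  stops-▻ (_ ◅ ch) step = cong (_ ∷_) (stops-▻ ch step)

  stops⊆X : ∀ {a c} (ch : Chain a c) → X a → All X (stops ch)
  stops⊆X ε                               Xa = Xa ∷ []
  stops⊆X ((_ , (_ , _ , Xb , _)) ◅ ch) Xa = Xa ∷ stops⊆X ch Xb

  noRepeat-[] : NoRepeatIn H X []
  noRepeat-[] _ _ []      _ _ ()
  noRepeat-[] _ _ (_ ∷ _) _ _ ()

  noRepeat-∷⁺ : ∀ {a l} → (X a → a ∉ l) → NoRepeatIn H X l → NoRepeatIn H X (a ∷ l)
  noRepeat-∷⁺ fresh _  _ Xx []       l₂ _  refl = fresh Xx (∈-++⁺ʳ l₂ (here refl))
  noRepeat-∷⁺ _     nr x Xx (_ ∷ l₁) l₂ l₃ refl = nr x Xx l₁ l₂ l₃ refl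

  noRepeat-∷⁻ : ∀ {a l} → NoRepeatIn H X (a ∷ l) → (X a → a ∉ l) × NoRepeatIn H X l
  noRepeat-∷⁻ nr =
    (λ Xa a∈ → let l₂ , l₃ , l≡ = ∈-∃++ a∈ in nr _ Xa [] l₂ l₃ (cong (_ ∷_) l≡)) ,
    (λ x Xx l₁ l₂ l₃ l≡ → nr x Xx (_ ∷ l₁) l₂ l₃ (cong (_ ∷_) l≡))

  noRepeat-++⁺ : ∀ m {l} → All (¬_ ∘ X) m → NoRepeatIn H X l → NoRepeatIn H X (m ++ l)
  noRepeat-++⁺ []      []          nr = nr
  noRepeat-++⁺ (x ∷ m) (¬Xx ∷ ¬Xm) nr = noRepeat-∷⁺ (λ Xx → ⊥-elim (¬Xx Xx)) (noRepeat-++⁺ m ¬Xm nr)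

  noRepeat-++⁻ʳ : ∀ m {l} → NoRepeatIn H X (m ++ l) → NoRepeatIn H X l
  noRepeat-++⁻ʳ []      nr = nr
  noRepeat-++⁻ʳ (x ∷ m) nr = noRepeat-++⁻ʳ m (proj₂ (noRepeat-∷⁻ nr))

  stops⊆verts : ∀ {a c} (ch : Chain a c) {x} → x ∈ stops ch → x ∈ verts H (walkOf ch)
  stops⊆verts ε              x∈          = x∈
  stops⊆verts ((s , _) ◅ ch) (here refl) = start∈verts (s ⊕ walkOf ch)
  stops⊆verts ((s , _) ◅ ch) (there x∈)  =
    subst (_ ∈_) (sym (verts-⊕ s (walkOf ch))) (∈-++⁺ʳ (initVerts s) (stops⊆verts ch x∈))

  X-verts⊆stops : ∀ {a c} (ch : Chain a c) {x} → x ∈ verts H (walkOf ch) → X x → x ∈ stops ch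
  X-verts⊆stops ε x∈ _ = x∈
  X-verts⊆stops (([] , ((() , _) , _)) ◅ _)
  X-verts⊆stops ((s@(_ ∷ _) , (_ , _ , _ , ia , _)) ◅ ch) {x} x∈ Xx
    with ∈-++⁻ (initVerts s) (subst (x ∈_) (verts-⊕ s (walkOf ch)) x∈)
  ... | inj₁ (here refl)     = here refl
  ... | inj₁ (there x∈inner) = ⊥-elim (All.lookup (InnerAvoid⇒All X s ia) x∈inner Xx)
  ... | inj₂ x∈rest          = there (X-verts⊆stops ch x∈rest Xx)

  concatLocal : ∀ {a c} (ch : Chain a c) → ConcatLocal H r X (walkOf ch)
  concatLocal ε               = c-nil
  concatLocal ((_ , lp) ◅ ch) = c-cons lp (concatLocal ch)

  concatLocal⇒chain : ∀ {a c} {w : Walk H a c} → ConcatLocal H r X w → Σ (Chain a c) λ ch → walkOf ch ≡ w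
  concatLocal⇒chain c-nil = ε , refl
  concatLocal⇒chain (c-cons {p = s} lp cl) with concatLocal⇒chain cl
  ... | ch , refl = (s , lp) ◅ ch , refl

  unique⇒noRepeat : ∀ {a c} (ch : Chain a c) → Unique (stops ch) → NoRepeatIn H X (verts H (walkOf ch))
  unique⇒noRepeat ε _ = noRepeat-∷⁺ (λ _ ()) noRepeat-[]
  unique⇒noRepeat (([] , ((() , _) , _)) ◅ _)
  unique⇒noRepeat ((s@(_ ∷ _) , (_ , _ , _ , ia , _)) ◅ ch) u@(_ ∷ u′) =
    subst (NoRepeatIn H X) (sym (verts-⊕ s (walkOf ch)))
      (noRepeat-∷⁺ fresh (noRepeat-++⁺ (inner s) (InnerAvoid⇒All X s ia) (unique⇒noRepeat ch u′)))
    where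
      fresh : X _ → _ ∉ inner s ++ verts H (walkOf ch)
      fresh Xa a∈ with ∈-++⁻ (inner s) a∈
      ... | inj₁ a∈inner = All.lookup (InnerAvoid⇒All X s ia) a∈inner Xa
      ... | inj₂ a∈rest  = Unique[x∷xs]⇒x∉xs u (X-verts⊆stops ch a∈rest Xa)

  noRepeat⇒unique : ∀ {a c} (ch : Chain a c) → X a → NoRepeatIn H X (verts H (walkOf ch)) → Unique (stops ch)
  noRepeat⇒unique ε _ _ = [] ∷ []
  noRepeat⇒unique (([] , ((() , _) , _)) ◅ _)
  noRepeat⇒unique ((s@(_ ∷ _) , (_ , _ , Xb , _)) ◅ ch) Xa nr
    with noRepeat-∷⁻ (subst (NoRepeatIn H X) (verts-⊕ s (walkOf ch)) nr)
  ... | fresh , nr′ =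
    All.¬Any⇒All¬ _ (λ a∈ → fresh Xa (∈-++⁺ʳ (inner s) (stops⊆verts ch a∈)))
    ∷ noRepeat⇒unique ch Xb (noRepeat-++⁻ʳ (inner s) nr′)

  chain⇒InW : ∀ {a c} (ch : Chain a c) → Unique (stops ch) → InW H r X (walkOf ch)
  chain⇒InW ch u = concatLocal ch , unique⇒noRepeat ch u

  InW⇒chain : ∀ {a c} {w : Walk H a c} → InW H r X w → X a → Σ (Chain a c) (Unique ∘ stops)
  InW⇒chain (cl , nr) Xa with concatLocal⇒chain cl
  ... | ch , refl = ch , noRepeat⇒unique ch Xa nr

  module Shortcut (_≟X_ : ∀ {u v} → X u → X v → Dec (u ≡ v)) where

    suffixFrom : ∀ {a c v} (ch : Chain a c) → v ∈ stops ch →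
                 Σ (Chain v c) λ ch′ → Σ (List V) λ pre → stops ch ≡ pre ++ stops ch′
    suffixFrom ε             (here refl) = ε , [] , refl
    suffixFrom ch@(_ ◅ _)    (here refl) = ch , [] , refl
    suffixFrom (step ◅ ch) (there v∈) with suffixFrom ch v∈
    ... | ch′ , pre , stops≡ = ch′ , _ ∷ pre , cong (_ ∷_) stops≡

    shortcut : ∀ {a b c} → X a → Chain a b → (ch : Chain b c) → Unique (stops ch) →
               Σ (Chain a c) (Unique ∘ stops)
    shortcut Xa ε ch u = ch , u
    shortcut Xa (step@(_ , (_ , _ , Xb , _)) ◅ ch₁) ch₂ u with shortcut Xb ch₁ ch₂ u
    ... | d , ud with ∈-dec _≟X_ Xa (stops⊆X d Xb)
    ...   | no a∉  = step ◅ d , All.¬Any⇒All¬ _ a∉ ∷ ud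
    ...   | yes a∈ with suffixFrom d a∈
    ...     | d′ , pre , stops≡ = d′ , Unique-++⁻ʳ pre (subst Unique stops≡ ud)

module Lifting (C G : Graph) (p : Graph.V C → Graph.V G) (cov : IsCovering C G p) where
  private
    module C = Graph C
    module G = Graph G
  open IsCovering cov

  data Over : ∀ {a b u v} → Walk C a b → Walk G u v → Set where
    over-[] : ∀ {a u} → p a ≡ u → Over ([] {u = a}) ([] {u = u})
    over-∷  : ∀ {a a′ b u u′ v} {ĉ : C.E a a′} {ŵ : Walk C a′ b} {e : G.E u u′} {w : Walk G u′ v} →
              p a ≡ u → Over ŵ w → Over (ĉ ∷ ŵ) (e ∷ w)

  over-start : ∀ {a b u v} {ŵ : Walk C a b} {w : Walk G u v} → Over ŵ w → p a ≡ u
  over-start (over-[] pa≡u)  = pa≡u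
  over-start (over-∷ pa≡u _) = pa≡u

  over-end : ∀ {a b u v} {ŵ : Walk C a b} {w : Walk G u v} → Over ŵ w → p b ≡ v
  over-end (over-[] pb≡v) = pb≡v
  over-end (over-∷ _ ŵ/w) = over-end ŵ/w

  over-len : ∀ {a b u v} {ŵ : Walk C a b} {w : Walk G u v} → Over ŵ w → len C ŵ ≡ len G w
  over-len (over-[] _)    = refl
  over-len (over-∷ _ ŵ/w) = cong suc (over-len ŵ/w)

  over-verts : ∀ {a b u v} {ŵ : Walk C a b} {w : Walk G u v} → Over ŵ w → map p (verts C ŵ) ≡ verts G w
  over-verts (over-[] pa≡u)    = cong [_] pa≡u
  over-verts (over-∷ pa≡u ŵ/w) = cong₂ _∷_ pa≡u (over-verts ŵ/w)

  over-edges : ∀ {a b u v} {ŵ : Walk C a b} {w : Walk G u v} → Over ŵ w →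
               map (λ (x , y) → p x , p y) (edges C ŵ) ≡ edges G w
  over-edges (over-[] _)       = refl
  over-edges (over-∷ pa≡u ŵ/w) = cong₂ _∷_ (cong₂ _,_ pa≡u (over-start ŵ/w)) (over-edges ŵ/w)

  lift : ∀ {u v} (a : C.V) → p a ≡ u → (w : Walk G u v) → Σ C.V λ b → Σ (Walk C a b) λ ŵ → Over ŵ w
  lift a refl []      = a , [] , over-[] refl
  lift a refl (e ∷ w) with loc-surj e
  ... | a′ , ĉ , pa′≡ with lift a′ pa′≡ w
  ...   | b , ŵ , ŵ/w = b , ĉ ∷ ŵ , over-∷ refl ŵ/w

  mapWalk-over : ∀ {a b} (ŵ : Walk C a b) → Over ŵ (mapWalk C G cov ŵ)
  mapWalk-over []      = over-[] refl
  mapWalk-over (e ∷ ŵ) = over-∷ refl (mapWalk-over ŵ)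

  over-⊕ : ∀ {a b c u v w} {ŵ₁ : Walk C a b} {ŵ₂ : Walk C b c} {w₁ : Walk G u v} {w₂ : Walk G v w} →
           Over ŵ₁ w₁ → Over ŵ₂ w₂ → Over (ŵ₁ ⊕ ŵ₂) (w₁ ⊕ w₂)
  over-⊕ (over-[] _)       ŵ₂/w₂ = ŵ₂/w₂
  over-⊕ (over-∷ pa≡u ŵ/w) ŵ₂/w₂ = over-∷ pa≡u (over-⊕ ŵ/w ŵ₂/w₂)

  over-split : ∀ {a b u m v} (w₁ : Walk G u m) (w₂ : Walk G m v) {ŵ : Walk C a b} → Over ŵ (w₁ ⊕ w₂) →
               Σ C.V λ m̂ → Σ (Walk C a m̂) λ ŵ₁ → Σ (Walk C m̂ b) λ ŵ₂ →
               ŵ ≡ ŵ₁ ⊕ ŵ₂ × Over ŵ₁ w₁ × Over ŵ₂ w₂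
  over-split []       w₂ {ŵ} ŵ/w = _ , [] , ŵ , refl , over-[] (over-start ŵ/w) , ŵ/w
  over-split (e ∷ w₁) w₂ (over-∷ {ĉ = ĉ} pa≡u ŵ/w) with over-split w₁ w₂ ŵ/w
  ... | m̂ , ŵ₁ , ŵ₂ , refl , ŵ₁/w₁ , ŵ₂/w₂ = m̂ , ĉ ∷ ŵ₁ , ŵ₂ , refl , over-∷ pa≡u ŵ₁/w₁ , ŵ₂/w₂

  over-rev : ∀ {a b u v} {ŵ : Walk C a b} {w : Walk G u v} → Over ŵ w → Over (rev C ŵ) (rev G w)
  over-rev (over-[] pa≡u)    = over-[] pa≡u
  over-rev (over-∷ pa≡u ŵ/w) = over-⊕ (over-rev ŵ/w) (over-∷ (over-start ŵ/w) (over-[] pa≡u))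

  over-end-unique : ∀ {a₁ a₂ b₁ b₂ u v} {ŵ₁ : Walk C a₁ b₁} {ŵ₂ : Walk C a₂ b₂} {w : Walk G u v} →
                    Over ŵ₁ w → Over ŵ₂ w → a₁ ≡ a₂ → b₁ ≡ b₂
  over-end-unique (over-[] _) (over-[] _) a₁≡a₂ = a₁≡a₂
  over-end-unique (over-∷ {ĉ = ĉ₁} _ ŵ₁/w) (over-∷ {ĉ = ĉ₂} _ ŵ₂/w) refl =
    over-end-unique ŵ₁/w ŵ₂/w (loc-inj ĉ₁ ĉ₂ (trans (over-start ŵ₁/w) (sym (over-start ŵ₂/w))))

  over-start-unique : ∀ {a₁ a₂ b₁ b₂ u v} {ŵ₁ : Walk C a₁ b₁} {ŵ₂ : Walk C a₂ b₂} {w : Walk G u v} →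
                      Over ŵ₁ w → Over ŵ₂ w → b₁ ≡ b₂ → a₁ ≡ a₂
  over-start-unique (over-[] _) (over-[] _) b₁≡b₂ = b₁≡b₂
  over-start-unique (over-∷ {ĉ = ĉ₁} pa₁ ŵ₁/w) (over-∷ {ĉ = ĉ₂} pa₂ ŵ₂/w) b₁≡b₂
    with over-start-unique ŵ₁/w ŵ₂/w b₁≡b₂
  ... | refl = loc-inj (C.E-sym ĉ₁) (C.E-sym ĉ₂) (trans pa₁ (sym pa₂))

  backtrack-lift-end : ∀ {u v} {w w′ : Walk G u v} → Backtrack G w w′ →
                       ∀ {a b b′} {ŵ : Walk C a b} {ŵ′ : Walk C a b′} → Over ŵ w → Over ŵ′ w′ → b ≡ b′
  backtrack-lift-end (bt pre e e′ post) ŵ/w ŵ′/w′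
    with over-split pre (e ∷ e′ ∷ post) ŵ/w | over-split pre post ŵ′/w′
  ... | _ , _ , _ , refl , pre₁ , over-∷ {ĉ = ĉ} pm≡ (over-∷ {ĉ = ĉ′} _ post₁)
      | _ , _ , _ , refl , pre₂ , post₂
    with over-end-unique pre₁ pre₂ refl
  ... | refl with loc-inj (C.E-sym ĉ) ĉ′ (trans pm≡ (sym (over-start post₁)))
  ...   | refl = over-end-unique post₁ post₂ refl

  homotopic-lift-end : ∀ {u v} {w w′ : Walk G u v} → _≃_ G w w′ →
                       ∀ {a b b′} {ŵ : Walk C a b} {ŵ′ : Walk C a b′} → Over ŵ w → Over ŵ′ w′ → b ≡ b′
  homotopic-lift-end ε ŵ/w ŵ′/w′ = over-end-unique ŵ/w ŵ′/w′ refl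
  homotopic-lift-end (_◅_ {j = w₁} step rest) {a} ŵ/w ŵ′/w′ with lift a (over-start ŵ/w) w₁
  ... | _ , _ , ŵ₁/w₁ with step
  ...   | fwd bk = trans (backtrack-lift-end bk ŵ/w ŵ₁/w₁) (homotopic-lift-end rest ŵ₁/w₁ ŵ′/w′)
  ...   | bwd bk = trans (sym (backtrack-lift-end bk ŵ₁/w₁ ŵ/w)) (homotopic-lift-end rest ŵ₁/w₁ ŵ′/w′)

module LocalLifting (C G : Graph) (r : ℕ) (p : Graph.V C → Graph.V G) (x̂₀ : Graph.V C)
                    (lc : IsLocalCovering C G r p x̂₀) where
  private
    module C = Graph C
    module G = Graph G
  open IsLocalCovering lc
  open IsCovering covering
  open Lifting C G p covering

  stemsShort⇒local : ∀ {x₀} {w : Walk G x₀ x₀} → StemsShort G r w → InLocalGroup G r w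
  stemsShort⇒local {w = w} stems = w ⊕ [] , gen-pos stems gen-nil , subst (_≃_ G w) (sym (⊕-identityʳ w)) ε

  -- Conjugated by the image W₀ of a walk from x̂₀, the walk around O lies in π₁ʳ, so it is the image of
  -- a closed walk at x̂₀; by homotopy lifting its lift from x̂₀ closes up, hence so does the middle part.
  shortCycle-lift-closed : ∀ {â b y} {Q : Walk G y y} {q̂ : Walk C â b} (O : Cycle G) →
                           ShortCycle G r O → Traverses G Q O → Over q̂ Q → b ≡ â
  shortCycle-lift-closed {â} {Q = Q} O short traverses q̂/Q with over-start q̂/Q
  ... | refl =
    let ŵ′ , ŵ′≃w = onto-local w (stemsShort⇒local (O , short , p â , W₀ , Q , traverses , refl))
        _ , _ , ŵ/w = lift x̂₀ refl w
        _ , _ , _ , _ , ĉ₁/W₀ , rest/ = over-split W₀ (Q ⊕ rev G W₀) ŵ/w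
        _ , _ , _ , _ , q̂′/Q , ĉ₃/W₀⁻ = over-split Q (rev G W₀) rest/
        b≡m₂ = over-end-unique q̂/Q q̂′/Q (over-end-unique (mapWalk-over c) ĉ₁/W₀ refl)
        m₂≡â = over-start-unique ĉ₃/W₀⁻ (over-rev (mapWalk-over c))
                 (sym (homotopic-lift-end ŵ′≃w (mapWalk-over ŵ′) ŵ/w))
    in trans b≡m₂ m₂≡â
    where
      c : Walk C x̂₀ â
      c = connected x̂₀ â
      W₀ : Walk G (p x̂₀) (p â)
      W₀ = mapWalk C G covering c
      w : Walk G (p x̂₀) (p x̂₀)
      w = W₀ ⊕ (Q ⊕ rev G W₀)

  ProjectsInjectively : Cycle C → Set
  ProjectsInjectively Ô = ∀ {x y} → x ∈ verts C (walk Ô) → y ∈ verts C (walk Ô) → p x ≡ p y → x ≡ y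

  -- Lift the final segment of the walk around O from c, then the whole walk from the end â of that lift;
  -- the result closes up and, by uniqueness of lifts, passes through c.
  lift-cycle-through : (O : Cycle G) → ShortCycle G r O → ∀ {c} → p c ∈ verts G (walk O) →
                       Σ (Cycle C) λ Ô → Over (walk Ô) (walk O) × ProjectsInjectively Ô × c ∈ verts C (walk Ô)
  lift-cycle-through O@(cyc b Q@(e₀ ∷ Q″) long inj) short {c} pc∈ with split-at Q pc∈
  ... | Q₁ , Q₂ , Q≡ with lift c refl Q₂
  ...   | â , q̂₂ , q̂₂/Q₂ with lift â (over-end q̂₂/Q₂) Q
  ...     | b′ , q̂ , q̂/Q with shortCycle-lift-closed O short (cycle-traverses O) q̂/Q
  ...       | refl with q̂ | q̂/Q
  ...         | ĉ₀ ∷ q̂″ | q̂/Q′@(over-∷ _ q̂″/Q″) =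
    cyc â (ĉ₀ ∷ q̂″) (subst (3 ≤_) (sym (over-len q̂/Q′)) long) (Unique.map⁻ uniqueImage) ,
    q̂/Q′ , injective , c∈
    where
      uniqueImage : Unique (map p (verts C q̂″))
      uniqueImage = subst Unique (sym (over-verts q̂″/Q″)) inj
      onTail : ∀ {x} → x ∈ verts C (ĉ₀ ∷ q̂″) → x ∈ verts C q̂″
      onTail (here refl) = end∈verts q̂″
      onTail (there x∈)  = x∈
      injective : ∀ {x y} → x ∈ verts C (ĉ₀ ∷ q̂″) → y ∈ verts C (ĉ₀ ∷ q̂″) → p x ≡ p y → x ≡ y
      injective x∈ y∈ = Unique-map⇒injective p uniqueImage (onTail x∈) (onTail y∈)
      c∈ : c ∈ verts C (ĉ₀ ∷ q̂″)
      c∈ with over-split Q₁ Q₂ (subst (Over (ĉ₀ ∷ q̂″)) Q≡ q̂/Q′)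
      ... | _ , q̂₁ , q̂₂′ , q̂≡ , _ , q̂₂′/Q₂ with over-start-unique q̂₂′/Q₂ q̂₂/Q₂ refl
      ...   | refl = subst (c ∈_) (sym (trans (cong (verts C) q̂≡) (verts-⊕ q̂₁ q̂₂′)))
                       (∈-++⁺ʳ (initVerts q̂₁) (start∈verts q̂₂′))

  edge-on-lifted-cycle : ∀ (O : Cycle G) (Ô : Cycle C) → Over (walk Ô) (walk O) → ProjectsInjectively Ô →
                         ∀ {c c₁} → C.E c c₁ → c ∈ verts C (walk Ô) → EdgeOf G O (p c , p c₁) →
                         EdgeOf C Ô (c , c₁) × c₁ ∈ verts C (walk Ô)
  edge-on-lifted-cycle O Ô Ô/O injective ĉ c∈ e∈O
    with find (Any.map⁻ (subst (Any (SameEdge G _)) (sym (over-edges Ô/O)) e∈O))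
  ... | f , f∈ , same with All.lookup (edges-traversed (walk Ô)) f∈ | same
  ...   | f̂ , x∈ , y∈ | inj₁ (pc≡px , pc₁≡py) with injective c∈ x∈ pc≡px
  ...     | refl with loc-inj ĉ f̂ pc₁≡py
  ...       | refl = lose f∈ (inj₁ (refl , refl)) , y∈
  edge-on-lifted-cycle O Ô Ô/O injective ĉ c∈ e∈O
      | f , f∈ , same | f̂ , x∈ , y∈ | inj₂ (pc≡py , pc₁≡px) with injective c∈ y∈ pc≡py
  ...     | refl with loc-inj ĉ (C.E-sym f̂) pc₁≡px
  ...       | refl = lose f∈ (inj₂ (refl , refl)) , x∈

  lift-contained : ∀ (O : Cycle G) (Ô : Cycle C) → Over (walk Ô) (walk O) → ProjectsInjectively Ô →
                   ∀ {c d u v} {ŝ : Walk C c d} {s : Walk G u v} → Over ŝ s → ContainedIn G s O →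
                   c ∈ verts C (walk Ô) → ContainedIn C ŝ Ô
  lift-contained O Ô Ô/O injective (over-[] _) _ _ = []
  lift-contained O Ô Ô/O injective (over-∷ {ĉ = ĉ} refl ŝ/s) (e∈O ∷ s⊆O) c∈
    with over-start ŝ/s
  ... | refl with edge-on-lifted-cycle O Ô Ô/O injective ĉ c∈ e∈O
  ...   | ĉ∈Ô , c₁∈ = ĉ∈Ô ∷ lift-contained O Ô Ô/O injective ŝ/s s⊆O c₁∈

  lift-onShortCycle : ∀ {c d u v} {ŝ : Walk C c d} {s : Walk G u v} → Over ŝ s → 1 ≤ len G s →
                      (O : Cycle G) → ShortCycle G r O → ContainedIn G s O →
                      Σ (Cycle C) λ Ô → ShortCycle C r Ô × ContainedIn C ŝ Ô
  lift-onShortCycle {s = s} ŝ/s nonempty O short s⊆O with over-start ŝ/s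
  ... | refl with lift-cycle-through O short (proj₁ (contained⇒ends-on-cycle s O nonempty s⊆O))
  ...   | Ô , Ô/O , injective , c∈ =
    Ô , subst (_≤ r) (sym (over-len Ô/O)) short , lift-contained O Ô Ô/O injective ŝ/s s⊆O c∈

  lift-localPath : ∀ (X : Subset G.V) {c d u v} {ŝ : Walk C c d} {s : Walk G u v} → Over ŝ s →
                   LocalXPath G r X s → LocalXPath C r (Preimage C G p X) ŝ
  lift-localPath X {ŝ = ŝ} {s} ŝ/s ((nonempty , u) , Xu , Xv , ia , local) =
    (subst (1 ≤_) (sym (over-len ŝ/s)) nonempty , Unique.map⁻ (subst Unique (sym (over-verts ŝ/s)) u)) ,
    subst X (sym (over-start ŝ/s)) Xu , subst X (sym (over-end ŝ/s)) Xv ,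
    innerAvoid ŝ/s ia , lifted local
    where
      innerAvoid : ∀ {c d u v} {ŝ : Walk C c d} {s : Walk G u v} → Over ŝ s →
                   InnerAvoid G X s → InnerAvoid C (Preimage C G p X) ŝ
      innerAvoid (over-[] _)                   _          = tt
      innerAvoid (over-∷ _ (over-[] _))        _          = tt
      innerAvoid (over-∷ _ ŝ/s@(over-∷ pw≡ _)) (¬Xw , ia) =
        (λ Xpw → ¬Xw (subst X pw≡ Xpw)) , innerAvoid ŝ/s ia
      lifted : ShortCycleOrEdge G r s → ShortCycleOrEdge C r ŝ
      lifted (inj₁ (O , short , s⊆O)) = inj₁ (lift-onShortCycle ŝ/s nonempty O short s⊆O)
      lifted (inj₂ single)            = inj₂ (trans (over-len ŝ/s) single)

module TomicJoined (H : Graph) (r : ℕ) (Xs : List (Graph.V H)) (uniqueXs : Unique Xs) where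
  open Graph H

  X : Subset V
  X v = v ∈ Xs

  open Chains H r X
  open Shortcut (∈-Unique-≟ uniqueXs)

  InW-[] : ∀ {a} → InW H r X ([] {u = a})
  InW-[] = chain⇒InW ε ([] ∷ [])

  InW-trans : ∀ {a b c} → X a → X b →
              Σ (Walk H a b) (InW H r X) → Σ (Walk H b c) (InW H r X) → Σ (Walk H a c) (InW H r X)
  InW-trans Xa Xb (_ , w₁) (_ , w₂) with InW⇒chain w₁ Xa | InW⇒chain w₂ Xb
  ... | ch₁ , _ | ch₂ , u₂ with shortcut Xa ch₁ ch₂ u₂
  ...   | ch , u = walkOf ch , chain⇒InW ch u

  LinkedWith : V → Subset V
  LinkedWith x y = X y × Σ (Walk H x y) (InW H r X) × Σ (Walk H y x) (InW H r X)

  linkedWith-self : ∀ {x} → X x → LinkedWith x x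
  linkedWith-self Xx = Xx , ([] , InW-[]) , ([] , InW-[])

  linkedWith-isTom : ∀ {x} → X x → IsTom H r X (LinkedWith x)
  linkedWith-isTom {x} Xx =
    (λ _ → proj₁) ,
    (λ a b (Xa , _ , a→x) (Xb , x→b , _) → InW-trans Xa Xx a→x x→b) ,
    λ Y x∈Y Y⊆X joinedY y Yy →
      let Yx = x∈Y x (linkedWith-self Xx)
      in Y⊆X y Yy , joinedY x y Yx Yy , joinedY y x Yy Yx

  tomic⇒joined : Tomic H r X → PairwiseJoined H r X X
  tomic⇒joined (T , (_ , joinedT , _) , unique) a b Xa Xb = joinedT a b (inT Xa) (inT Xb)
    where
      inT : ∀ {x} → X x → T x
      inT {x} Xx = proj₁ (unique (LinkedWith x) (linkedWith-isTom Xx)) x (linkedWith-self Xx)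

module FibreSeparation (C G : Graph) (p : Graph.V C → Graph.V G) (cov : IsCovering C G p) (r k : ℕ)
                       (displacement : DisplacementAbove C G p (k * r))
                       (Xs : List (Graph.V G)) (uniqueXs : Unique Xs) (|Xs|≤k : length Xs ≤ k) where
  private
    module C = Graph C
    module G = Graph G

  X̂ : Subset C.V
  X̂ = Preimage C G p (_∈ Xs)

  open Chains C r X̂

  Apart : C.V → C.V → Set
  Apart u v = p u ≢ p v

  apart-or-same : ∀ {u v} → X̂ u → X̂ v → Apart u v ⊎ p u ≡ p v
  apart-or-same X̂u X̂v with ∈-Unique-≟ uniqueXs X̂u X̂v
  ... | yes same = inj₂ same
  ... | no apart = inj₁ apart

  apart⇒length≤k : ∀ {M} → All X̂ M → AllPairs Apart M → length M ≤ k
  apart⇒length≤k {M} X̂M apart =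
    ≤-trans (subst (_≤ length Xs) (length-map p M) (Unique-⊆⇒length-≤ (AllPairs.map⁺ apart) image⊆Xs))
            |Xs|≤k
    where
      image⊆Xs : ∀ {y} → y ∈ map p M → y ∈ Xs
      image⊆Xs y∈ with ∈-map⁻ p y∈
      ... | x , x∈ , refl = All.lookup X̂M x∈

  -- If p x = p y for a later y, take the first such y: the stops strictly before it have distinct
  -- images, so there are at most k of them and y is within distance kr/2 of x, against the displacement.
  separated : ∀ {L} → All X̂ L → Unique L → Linked (WithinHalf C r) L → AllPairs Apart L
  separated []                   _             _      = []
  separated {x ∷ L} (X̂x ∷ X̂L) (x∉L ∷ uniqueL) linked = apartFromHead ∷ apartL
    where
      apartL : AllPairs Apart L
      apartL = separated X̂L uniqueL (Linked.tail linked)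
      apartFromHead : All (Apart x) L
      apartFromHead with allOrFirst (apart-or-same X̂x) X̂L
      ... | inj₁ apart = apart
      ... | inj₂ (First._++_∷_ {xs = B} {y} apartB same _) with withinHalf-span B linked
      ...   | w , 2|w|≤ = ⊥-elim (<⇒≱ (displacement x y (All.lookup x∉L (∈-++⁺ʳ B (here refl))) same w)
                                      (≤-trans 2|w|≤ (*-monoˡ-≤ r (apart⇒length≤k (X̂x ∷ All.++⁻ˡ B X̂L)
                                                                     (apartB ∷ AllPairs-++⁻ˡ B apartL)))))

  localStep-withinHalf : 2 ≤ r → ∀ {a b} → LocalStep a b → WithinHalf C r a b
  localStep-withinHalf _   (s , ((nonempty , _) , _ , _ , _ , inj₁ (O , short , s⊆O))) =
    localPath-withinHalf s O short nonempty s⊆O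
  localStep-withinHalf 2≤r (s , (_ , _ , _ , _ , inj₂ single)) = s , subst (λ n → 2 * n ≤ r) (sym single) 2≤r

  stops-linked : 2 ≤ r → ∀ {a c} (ch : Chain a c) → Linked (WithinHalf C r) (stops ch)
  stops-linked _   ε                    = [-]
  stops-linked 2≤r (step ◅ ε)           = localStep-withinHalf 2≤r step ∷ [-]
  stops-linked 2≤r (step ◅ ch@(_ ◅ _)) = localStep-withinHalf 2≤r step ∷ stops-linked 2≤r ch

  -- With a single fibre in play, both ends of a local path lie in it, yet they are distinct and
  -- within distance r/2 (or adjacent, which p would map to a loop).
  unitWidth-noLocalStep : k ≡ 1 → ∀ {a b} → LocalStep a b → ⊥
  unitWidth-noLocalStep refl (s , (path@(nonempty , _) , X̂a , X̂b , _ , inj₁ (O , short , s⊆O)))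
    with localPath-withinHalf s O short nonempty s⊆O
  ... | w , 2|w|≤r =
    <⇒≱ (displacement _ _ (path-ends-distinct s path) (length≤1⇒∈-unique |Xs|≤k X̂a X̂b) w)
        (subst (2 * len C w ≤_) (sym (+-identityʳ r)) 2|w|≤r)
  unitWidth-noLocalStep refl (s , (_ , X̂a , X̂b , _ , inj₂ single)) =
    G.E-irr (subst (G.E _) (sym (length≤1⇒∈-unique |Xs|≤k X̂a X̂b)) (IsCovering.hom cov (length-1⇒edge s single)))

  fibre-trivial : (2 ≤ r ⊎ k ≡ 1) → ∀ {a b} (ch : Chain a b) → Unique (stops ch) → p a ≡ p b → a ≡ b
  fibre-trivial _          ε          _ _ = refl
  fibre-trivial (inj₂ k≡1) (step ◅ _) _ _ = ⊥-elim (unitWidth-noLocalStep k≡1 step)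
  fibre-trivial (inj₁ 2≤r) ch@(step@(_ , (_ , X̂a , _)) ◅ ch′) unique pa≡pb
    with separated (stops⊆X ch X̂a) unique (stops-linked 2≤r ch)
  ... | apartFromStart ∷ _ = ⊥-elim (All.lookup apartFromStart (end∈stops ch′) pa≡pb)

module SheetConstruction (C G : Graph) (r : ℕ) (p : Graph.V C → Graph.V G) (x̂₀ : Graph.V C)
                         (lc : IsLocalCovering C G r p x̂₀)
                         (Xs : List (Graph.V G)) (uniqueXs : Unique Xs) where
  private
    module C = Graph C
    module G = Graph G
  open IsLocalCovering lc using (covering)
  open Lifting C G p covering
  open LocalLifting C G r p x̂₀ lc

  X : Subset G.V
  X v = v ∈ Xs

  X̂ : Subset C.V
  X̂ = Preimage C G p X

  module ChG = Chains G r X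
  module ChC = Chains C r X̂

  FibresSeparated : Set
  FibresSeparated = ∀ {a b} (ch : ChC.Chain a b) → Unique (ChC.stops ch) → p a ≡ p b → a ≡ b

  record PartialSheet : Set where
    field
      L      : List C.V
      over-X : All X̂ L
      inj    : Unique (map p L)
      joined : ∀ {u v} → u ∈ L → v ∈ L →
               Σ (ChC.Chain u v) λ ch → Unique (ChC.stops ch) × All (_∈ L) (ChC.stops ch)
  open PartialSheet

  _⊑_ : PartialSheet → PartialSheet → Set
  S ⊑ S′ = ∀ {x} → x ∈ L S → x ∈ L S′

  Covers : PartialSheet → G.V → Set
  Covers S y = y ∈ map p (L S)

  covers-mono : ∀ {S S′ y} → S ⊑ S′ → Covers S y → Covers S′ y
  covers-mono S⊑S′ y∈ with ∈-map⁻ p y∈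
  ... | x , x∈ , refl = ∈-map⁺ p (S⊑S′ x∈)

  covers? : ∀ S {y} → X y → Dec (Covers S y)
  covers? S Xy = ∈-dec (∈-Unique-≟ uniqueXs) Xy (All.map⁺ (over-X S))

  singleSheet : (x̂ : C.V) → X̂ x̂ → PartialSheet
  singleSheet x̂ X̂x̂ = record
    { L      = [ x̂ ]
    ; over-X = X̂x̂ ∷ []
    ; inj    = [] ∷ []
    ; joined = λ { (here refl) (here refl) → ε , [] ∷ [] , here refl ∷ [] }
    }

  extend : ∀ S {l b} → l ∈ L S → ChG.LocalStep (p l) b → ¬ Covers S b →
           Σ PartialSheet λ S′ → Covers S′ b × S ⊑ S′
  extend S {l} l∈ (s , local@(_ , _ , Xb , _)) uncovered with lift l refl s
  ... | ŵ , ŝ , ŝ/s = S′ , here (sym (over-end ŝ/s)) , there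
    where
      forward : ChC.LocalStep l ŵ
      forward = ŝ , lift-localPath X ŝ/s local
      backward : ChC.LocalStep ŵ l
      backward = rev C ŝ , LocalXPath-rev X̂ (proj₂ forward)
      ŵ∉L : ŵ ∉ L S
      ŵ∉L ŵ∈ = uncovered (subst (_∈ map p (L S)) (over-end ŝ/s) (∈-map⁺ p ŵ∈))
      joined′ : ∀ {u v} → u ∈ ŵ ∷ L S → v ∈ ŵ ∷ L S →
                Σ (ChC.Chain u v) λ ch → Unique (ChC.stops ch) × All (_∈ ŵ ∷ L S) (ChC.stops ch)
      joined′ (here refl) (here refl) = ε , [] ∷ [] , here refl ∷ []
      joined′ (here refl) (there v∈) =
        let ch , unique , ⊆L = joined S l∈ v∈
        in backward ◅ ch ,
           All.¬Any⇒All¬ _ (ŵ∉L ∘ All.lookup ⊆L) ∷ unique ,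
           here refl ∷ All.map there ⊆L
      joined′ (there u∈) (here refl) =
        let ch , unique , ⊆L = joined S u∈ l∈
        in ch ◅◅ (forward ◅ ε) ,
           subst Unique (sym (ChC.stops-▻ ch forward))
             (Unique.++⁺ unique ([] ∷ []) λ { (v∈ , here refl) → ŵ∉L (All.lookup ⊆L v∈) }) ,
           subst (All (_∈ ŵ ∷ L S)) (sym (ChC.stops-▻ ch forward))
             (All.++⁺ (All.map there ⊆L) (here refl ∷ []))
      joined′ (there u∈) (there v∈) =
        let ch , unique , ⊆L = joined S u∈ v∈ in ch , unique , All.map there ⊆L
      S′ : PartialSheet
      S′ = record
        { L      = ŵ ∷ L S
        ; over-X = subst X (sym (over-end ŝ/s)) Xb ∷ over-X S
        ; inj    = All.¬Any⇒All¬ _ (subst (_∉ map p (L S)) (sym (over-end ŝ/s)) uncovered) ∷ inj S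
        ; joined = joined′
        }

  coverAlong : ∀ S {a y} → ChG.Chain a y → Covers S a → Σ PartialSheet λ S′ → Covers S′ y × S ⊑ S′
  coverAlong S ε a∈ = S , a∈ , λ x∈ → x∈
  coverAlong S (step@(_ , (_ , _ , Xb , _)) ◅ g) a∈ with covers? S Xb | ∈-map⁻ p a∈
  ... | yes b∈ | _ = coverAlong S g b∈
  ... | no b∉  | l , l∈ , refl =
    let S′ , b∈′ , S⊑S′ = extend S l∈ step b∉
        S″ , y∈ , S′⊑S″ = coverAlong S′ g b∈′
    in S″ , y∈ , λ x∈ → S′⊑S″ (S⊑S′ x∈)

  module _ (joinedX : PairwiseJoined G r X X) where

    chainBetween : ∀ {x y} → X x → X y → ChG.Chain x y
    chainBetween Xx Xy = proj₁ (ChG.InW⇒chain (proj₂ (joinedX _ _ Xx Xy)) Xx)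

    coverFrom : ∀ S {x₀} → X x₀ → Covers S x₀ → (ys : List G.V) → All X ys →
                Σ PartialSheet λ S′ → All (Covers S′) ys × S ⊑ S′
    coverFrom S X₀ c₀ []       []          = S , [] , λ x∈ → x∈
    coverFrom S X₀ c₀ (y ∷ ys) (Xy ∷ Xys) =
      let S′ , cy  , S⊑S′  = coverAlong S (chainBetween X₀ Xy) c₀
          S″ , cys , S′⊑S″ = coverFrom S′ X₀ (covers-mono {S} {S′} S⊑S′ c₀) ys Xys
      in S″ , covers-mono {S′} {S″} S′⊑S″ cy ∷ cys , λ x∈ → S′⊑S″ (S⊑S′ x∈)

    sheetOver : (ys : List G.V) → All X ys → Σ PartialSheet λ S → All (Covers S) ys
    sheetOver []       []          = record { L = [] ; over-X = [] ; inj = [] ; joined = λ () } , []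
    sheetOver (y ∷ ys) Xys@(Xy ∷ _) with IsCovering.surj covering y
    ... | ŷ , pŷ≡y =
      let S , covered , _ =
            coverFrom (singleSheet ŷ (subst X (sym pŷ≡y) Xy)) Xy (here (sym pŷ≡y)) (y ∷ ys) Xys
      in S , covered

    built : Σ PartialSheet λ S → All (Covers S) Xs
    built = sheetOver Xs (All.tabulate λ x∈ → x∈)

    sheet : PartialSheet
    sheet = proj₁ built

    sheet-covers : All (Covers sheet) Xs
    sheet-covers = proj₂ built

    sheet-isTom : FibresSeparated → IsTom C r X̂ (_∈ L sheet)
    sheet-isTom separated = (λ _ → All.lookup (over-X sheet)) , joinedInW , maximal
      where
        joinedInW : PairwiseJoined C r X̂ (_∈ L sheet)
        joinedInW a b a∈ b∈ =
          let ch , unique , _ = joined sheet a∈ b∈ in ChC.walkOf ch , ChC.chain⇒InW ch unique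
        maximal : ∀ (Y : Subset C.V) → (_∈ L sheet) ⊆ Y → Y ⊆ X̂ → PairwiseJoined C r X̂ Y → Y ⊆ (_∈ L sheet)
        maximal Y L⊆Y Y⊆X̂ joinedY v Yv with ∈-map⁻ p (All.lookup sheet-covers (Y⊆X̂ v Yv))
        ... | l , l∈ , pv≡pl with ChC.InW⇒chain (proj₂ (joinedY v l Yv (L⊆Y l l∈))) (Y⊆X̂ v Yv)
        ...   | ch , unique = subst (_∈ L sheet) (sym (separated ch unique pv≡pl)) l∈

    oneSheet : FibresSeparated →
               Σ (Subset C.V) λ X̂′ → IsTom C r X̂ X̂′ ×
                 (∀ a b → X̂′ a → X̂′ b → p a ≡ p b → a ≡ b) × (∀ x → X x → Σ C.V λ a → X̂′ a × p a ≡ x)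
    oneSheet separated =
      (_∈ L sheet) , sheet-isTom separated ,
      (λ a b a∈ b∈ → Unique-map⇒injective p (inj sheet) a∈ b∈) ,
      λ x Xx → let a , a∈ , x≡pa = ∈-map⁻ p (All.lookup sheet-covers Xx) in a , a∈ , sym x≡pa

lemma5p7 : (G : Graph) → Connected G → (r k : ℕ) → (2 ≤ r ⊎ k ≡ 1) →
    (C : Graph) (p : Graph.V C → Graph.V G) (x̂₀ : Graph.V C) →
    IsLocalCovering C G r p x̂₀ →
    DisplacementAbove C G p (k * r) →
    (X : List (Graph.V G)) → Unique X → length X ≤ k →
    (Tomic G r (λ v → v ∈ X) → OneSheeted C G r p (λ v → v ∈ X)) ×
    (OneSheeted C G r p (λ v → v ∈ X) → Tomic G r (λ v → v ∈ X))
lemma5p7 G _ r k width C p x̂₀ lc displacement X uniqueX |X|≤k =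
  (λ tomic → tomic , oneSheet (tomic⇒joined tomic) (fibre-trivial width)) , proj₁
  where
    open TomicJoined G r X uniqueX using (tomic⇒joined)
    open FibreSeparation C G p (IsLocalCovering.covering lc) r k displacement X uniqueX |X|≤k
      using (fibre-trivial)
    open SheetConstruction C G r p x̂₀ lc X uniqueX using (oneSheet)
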